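{- Let $B=(P,\rightsquigarrow)$ be a dependent valence system over $\mathbb{M}G$ and $q_1,q_2\in P$. If $B$ has a run from $(q_1,\varepsilon)$ to $(q_2,u)$, then its saturation $\mathrm{sat}(B)$ has a run from $(q_1,\varepsilon)$ to $(q_2,v)$ for some irreducible $v$ with $u\cong v$; conversely, if $\mathrm{sat}(B)$ has a run from $(q_1,\varepsilon)$ to $(q_2,v)$ with $v$ irreducible, then $B$ has a run from $(q_1,\varepsilon)$ to $(q_2,u)$ for some $u\cong v$.
   Context: Let $G=(V,I)$ be an undirected graph ($I$ symmetric, self-loops allowed); $\mathrm{Ops}=\{o^+,o^-\mid o\in V\}$; $\cong$ the smallest congruence on $\mathrm{Ops}^*$ with $o_1^{\pm}o_2^{\pm}\cong o_2^{\pm}o_1^{\pm}$ for $o_1\,I\,o_2$ and $o^+o^-\cong\varepsilon$; $\mathbb{M}G=\mathrm{Ops}^*/\!\cong$, $[w]$ the class, $1=[\varepsilon]$; $w$ is right-invertible if $[w][y]=1$ for some $y$. A valence system over $\mathbb{M}G$ is $(Q,\to)$ with $Q$ finite and $\to\subseteq Q\times(\mathrm{Ops}\cup\{\varepsilon\})\times Q$; configurations are $(q,w)\in Q\times\mathrm{Ops}^*$; a transition $(q_1,x,q_2)$ is enabled in $(q,w)$ iff $q=q_1$ and $wx$ is right-invertible, and leads to $(q_2,wx)$; runs are sequences of such steps. A set of symbols is dependent if it contains no two distinct independent symbols; a valence system is dependent if the set of operations labelling its transitions is dependent. A word is irreducible if it cannot be written as $w'\,a\,w_I\,b\,w''$ with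 either ($a=o^+$, $b=o^-$, $o$ commutes with every symbol occurring in $w_I$) or ($a=o^-$, $b=o^+$, $o\,I\,o$, $o$ commutes with every symbol occurring in $w_I$). The saturation $\mathrm{sat}(B)=(P,\rightsquigarrow_{\mathrm{sat}})$ has the same states, $\rightsquigarrow\subseteq\rightsquigarrow_{\mathrm{sat}}$, and is closed under exhaustively applying: (1) if $p_1\xrightarrow{o^+}p$, $p\to^*p'$ via $\varepsilon$-transitions, and $p'\xrightarrow{o^- }p_2$ in $\rightsquigarrow_{\mathrm{sat}}$, add an $\varepsilon$-transition $p_1\to p_2$; (2) if $p_1\xrightarrow{o^- }p$, $p\to^*p'$ via $\varepsilon$-transitions, $p'\xrightarrow{o^+}p_2$ and $o\,I\,o$, add an $\varepsilon$-transition $p_1\to p_2$. -}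

module Defs where

open import Data.Nat using (ℕ)
open import Data.Fin using (Fin)
open import Data.List using (List; []; _∷_; _++_; [_])
open import Data.List.Relation.Unary.All using (All)
open import Data.Maybe using (Maybe; just; nothing; maybe)
open import Data.Product using (_×_; _,_; ∃; Σ)
open import Data.Sum using (_⊎_)
open import Relation.Binary.PropositionalEquality using (_≡_; _≢_)
open import Relation.Binary.Construct.Closure.ReflexiveTransitive using (Star)
open import Relation.Nullary using (¬_)
open import Level using (0ℓ) renaming (suc to lsuc)

-- Undirected graph on a finite vertex set, self-loops allowed.
record Graph : Set₁ where
  field
    size : ℕ
    I    : Fin size → Fin size → Set
    I-sym : ∀ {a b} → I a b → I b a

module _ (G : Graph) where
  open Graph G

  Vtx : Set
  Vtx = Fin size

  data Pol : Set where
    plus minus : Pol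

  -- o⁺ is (o , plus), o⁻ is (o , minus)
  Op : Set
  Op = Vtx × Pol

  vtx : Op → Vtx
  vtx (o , _) = o

  Word : Set
  Word = List Op

  Indep : Op → Op → Set
  Indep x y = I (vtx x) (vtx y)

  infix 4 _≅_
  data _≅_ : Word → Word → Set where
    ≅-refl  : ∀ {u} → u ≅ u
    ≅-sym   : ∀ {u v} → u ≅ v → v ≅ u
    ≅-trans : ∀ {u v w} → u ≅ v → v ≅ w → u ≅ w
    ≅-ctx   : ∀ {u v} (x y : Word) → u ≅ v → x ++ u ++ y ≅ x ++ v ++ y
    ≅-comm  : ∀ (a b : Op) → Indep a b → a ∷ b ∷ [] ≅ b ∷ a ∷ []
    ≅-cancel : ∀ (o : Vtx) → (o , plus) ∷ (o , minus) ∷ [] ≅ []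

  RightInvertible : Word → Set
  RightInvertible w = ∃ λ y → w ++ y ≅ []

  -- append an optional operation (nothing = ε)
  _·_ : Word → Maybe Op → Word
  w · x = w ++ maybe [_] [] x

  Irreducible : Word → Set
  Irreducible w = ¬ (Σ Word λ w' → Σ Op λ a → Σ Word λ wI → Σ Op λ b → Σ Word λ w'' →
      (w ≡ w' ++ a ∷ wI ++ b ∷ w'') ×
      ((∃ λ o → a ≡ (o , plus) × b ≡ (o , minus) × All (λ s → I o (vtx s)) wI)
       ⊎ (∃ λ o → a ≡ (o , minus) × b ≡ (o , plus) × I o o × All (λ s → I o (vtx s)) wI)))

  record VS : Set₁ where
    field
      states : ℕ
      Trans  : Fin states → Maybe Op → Fin states → Set

  module _ (B : VS) where
    open VS B

    State : Set
    State = Fin states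

    Config : Set
    Config = State × Word

    data Step : Config → Config → Set where
      step : ∀ {q q' w} (x : Maybe Op) → Trans q x q' → RightInvertible (w · x) →
             Step (q , w) (q' , w · x)

    Run : Config → Config → Set
    Run = Star Step

    Dependent : Set
    Dependent = ∀ {p₁ p₂ p₃ p₄} {x y : Op} → Trans p₁ (just x) p₂ → Trans p₃ (just y) p₄ →
                x ≢ y → ¬ Indep x y

    mutual
      data SatTrans : State → Maybe Op → State → Set where
        base  : ∀ {p x p'} → Trans p x p' → SatTrans p x p'
        rule1 : ∀ {p₁ p p' p₂} (o : Vtx) → SatTrans p₁ (just (o , plus)) p → EpsPath p p' →
                SatTrans p' (just (o , minus)) p₂ → SatTrans p₁ nothing p₂
        rule2 : ∀ {p₁ p p' p₂} (o : Vtx) → SatTrans p₁ (just (o , minus)) p → EpsPath p p' →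
                SatTrans p' (just (o , plus)) p₂ → I o o → SatTrans p₁ nothing p₂

      data EpsPath : State → State → Set where
        ε-refl : ∀ {p} → EpsPath p p
        ε-step : ∀ {p p' p''} → SatTrans p nothing p' → EpsPath p' p'' → EpsPath p p''

  sat : VS → VS
  sat B = record { states = VS.states B ; Trans = SatTrans B }

module Submission where

-- Lemma 20: runs of a dependent valence system B and runs of its saturation
-- sat(B) reach the same states, the latter with an irreducible counter in the
-- same class of 𝕄G.
--   * Congruence: closure properties of ≅ and of right-invertibility.
--   * Irreducibility: over a dependent alphabet, appending b to an irreducible v
--     keeps it irreducible unless v ends in o⁺ and b = o⁻, since any other redex
--     ending at b would contain two distinct independent letters.
--   * Expansion (sat(B) ⇒ B): an ε-transition added by saturation is replayed in
--     B as o^± (replayed ε-path) o^∓, leaving the class of the counter unchanged.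
--   * Normalisation (B ⇒ sat(B)): read a B-run letter by letter, maintaining a
--     sat(B)-run with an irreducible counter ≅ the current one; a new letter is
--     pushed, or cancels the last pushed o⁺ and is absorbed by rule (1).

open import Defs
open import Data.List using ([]; _∷_; _++_; [_]; initLast; _∷ʳ′_)
open import Data.List.Properties using (++-identityʳ; ++-assoc; ∷ʳ-injective)
open import Data.List.Relation.Unary.All using (All; []; _∷_)
open import Data.List.Relation.Unary.All.Properties using (++⁺; ++⁻ˡ; ++⁻ʳ)
open import Data.Maybe using (just; nothing)
open import Data.Product using (_×_; _,_; ∃; ∃₂; proj₁)
open import Data.Sum using (_⊎_; inj₁; inj₂)
open import Data.Fin using (_≟_)
open import Relation.Nullary using (¬_; Dec; yes; no)
open import Relation.Binary.PropositionalEquality using (_≡_; _≢_; refl; sym; trans; cong; subst)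
open import Relation.Binary.Construct.Closure.ReflexiveTransitive using (ε; _◅_; _◅◅_)

module Congruence (G : Graph) where
  open Graph G using (I)

  infix 4 _≈_
  _≈_ : Word G → Word G → Set
  _≈_ = _≅_ G

  RI : Word G → Set
  RI = RightInvertible G

  ≡⇒≈ : ∀ {u v} → u ≡ v → u ≈ v
  ≡⇒≈ refl = ≅-refl

  ≈-unitʳ : ∀ w → w ++ [] ≈ w
  ≈-unitʳ w = ≡⇒≈ (++-identityʳ w)

  ≈-appendʳ : ∀ {u v} z → u ≈ v → u ++ z ≈ v ++ z
  ≈-appendʳ z e = ≅-ctx [] z e

  ≈-prependˡ : ∀ {u v} x → u ≈ v → x ++ u ≈ x ++ v
  ≈-prependˡ {u} {v} x e =
    ≅-trans (≡⇒≈ (sym (cong (x ++_) (++-identityʳ u))))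
      (≅-trans (≅-ctx x [] e) (≡⇒≈ (cong (x ++_) (++-identityʳ v))))

  -- o⁻o⁺ cancels whenever o is a self-loop (the justification of rule (2)).
  minus-plus : ∀ o → I o o → (o , minus) ∷ (o , plus) ∷ [] ≈ []
  minus-plus o Ioo = ≅-trans (≅-comm (o , minus) (o , plus) Ioo) (≅-cancel o)

  cancel-pair : ∀ w x y → x ∷ y ∷ [] ≈ [] → (w ++ [ x ]) ++ [ y ] ≈ w
  cancel-pair w x y c =
    ≅-trans (≡⇒≈ (++-assoc w [ x ] [ y ])) (≅-trans (≈-prependˡ w c) (≈-unitʳ w))

  RI-resp : ∀ {u v} → u ≈ v → RI u → RI v
  RI-resp e (y , wy≈ε) = y , ≅-trans (≈-appendʳ y (≅-sym e)) wy≈ε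

  RI-[] : RI []
  RI-[] = [] , ≅-refl

  RI-extend : ∀ w x y → x ∷ y ∷ [] ≈ [] → RI w → RI (w ++ [ x ])
  RI-extend w x y c (z , wz≈ε) =
    y ∷ z , ≅-trans (≡⇒≈ (sym (++-assoc (w ++ [ x ]) [ y ] z)))
                    (≅-trans (≈-appendʳ z (cancel-pair w x y c)) wz≈ε)

module Irreducibility (G : Graph) where
  open Graph G using (I; I-sym)

  Redex : Op G → Word G → Op G → Set
  Redex a wI b =
    (∃ λ o → a ≡ (o , plus) × b ≡ (o , minus) × All (λ s → I o (vtx G s)) wI)
    ⊎ (∃ λ o → a ≡ (o , minus) × b ≡ (o , plus) × I o o × All (λ s → I o (vtx G s)) wI)

  Cancelling : Op G → Op G → Set
  Cancelling a b = ∃ λ o → a ≡ (o , plus) × b ≡ (o , minus)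

  cancelling? : ∀ a b → Dec (Cancelling a b)
  cancelling? (o , plus) (o' , minus) with o ≟ o'
  ... | yes refl = yes (o , refl , refl)
  ... | no o≢o'  = no λ { (_ , refl , refl) → o≢o' refl }
  cancelling? (o , plus)  (o' , plus) = no λ { (_ , _ , ()) }
  cancelling? (o , minus) b           = no λ { (_ , () , _) }

  CancelsLast : Word G → Op G → Set
  CancelsLast v b = ∃₂ λ w a → v ≡ w ++ [ a ] × Cancelling a b

  ¬CancelsLast-[] : ∀ {b} → ¬ CancelsLast [] b
  ¬CancelsLast-[] ([]    , _ , () , _)
  ¬CancelsLast-[] (_ ∷ _ , _ , () , _)

  CancelsLast-snoc : ∀ v a b → CancelsLast (v ++ [ a ]) b → Cancelling a b
  CancelsLast-snoc v a b (w , a' , eq , c) with ∷ʳ-injective v w eq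
  ... | _ , refl = c

  DependentAlphabet : (Op G → Set) → Set
  DependentAlphabet A = ∀ {x y} → A x → A y → x ≢ y → ¬ Indep G x y

  irreducible-[] : Irreducible G []
  irreducible-[] ([]    , _ , _ , _ , _ , () , _)
  irreducible-[] (_ ∷ _ , _ , _ , _ , _ , () , _)

  factor-snoc : ∀ w' (a : Op G) wI b w'' c →
                w' ++ a ∷ wI ++ b ∷ (w'' ++ [ c ]) ≡ (w' ++ a ∷ wI ++ b ∷ w'') ++ [ c ]
  factor-snoc w' a wI b w'' c =
    trans (cong (λ z → w' ++ a ∷ z) (sym (++-assoc wI (b ∷ w'') [ c ])))
          (sym (++-assoc w' (a ∷ wI ++ b ∷ w'') [ c ]))

  irreducible-prefix : ∀ v c → Irreducible G (v ++ [ c ]) → Irreducible G v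
  irreducible-prefix v c irr (w' , a , wI , b , w'' , eq , redex) =
    irr (w' , a , wI , b , w'' ++ [ c ] ,
         trans (cong (_++ [ c ]) eq) (sym (factor-snoc w' a wI b w'' c)) , redex)

  -- Over a dependent alphabet, a redex a wI b whose prefix w' a wI is irreducible
  -- can only be an adjacent o⁺ o⁻: a first letter of wI different from o⁻ would be
  -- independent of b = o⁻, and o⁻ wI o⁺ would make o⁻ and o⁺ independent.
  redex-is-cancelling : ∀ {A} → DependentAlphabet A → ∀ w' a wI b →
    Irreducible G (w' ++ a ∷ wI) → All A (w' ++ a ∷ wI) → A b →
    ¬ CancelsLast (w' ++ a ∷ wI) b → ¬ Redex a wI b
  redex-is-cancelling dep w' a [] b irr all-A Ab ¬c (inj₁ (o , refl , refl , [])) =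
    ¬c (w' , a , refl , o , refl , refl)
  redex-is-cancelling dep w' a (s ∷ r) b irr all-A Ab ¬c (inj₁ (o , refl , refl , Ios ∷ _))
    with cancelling? a s
  ... | yes (_ , refl , refl) = irr (w' , a , [] , s , r , refl , inj₁ (o , refl , refl , []))
  ... | no ¬as with ++⁻ʳ w' all-A
  ...   | _ ∷ As ∷ _ = dep As Ab (λ s≡b → ¬as (o , refl , s≡b)) (I-sym Ios)
  redex-is-cancelling dep w' a wI b irr all-A Ab ¬c (inj₂ (o , refl , refl , Ioo , _))
    with ++⁻ʳ w' all-A
  ... | Aa ∷ _ = dep Aa Ab (λ ()) Ioo

  irreducible-snoc : ∀ {A} → DependentAlphabet A → ∀ v b → Irreducible G v → All A v → A b →
                     ¬ CancelsLast v b → Irreducible G (v ++ [ b ])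
  irreducible-snoc dep v b irr all-A Ab ¬c (w' , a , wI , b' , w'' , eq , redex)
    with initLast w''
  ... | [] with ∷ʳ-injective v (w' ++ a ∷ wI) (trans eq (sym (++-assoc w' (a ∷ wI) [ b' ])))
  ...   | refl , refl = redex-is-cancelling dep w' a wI b irr all-A Ab ¬c redex
  irreducible-snoc dep v b irr all-A Ab ¬c (w' , a , wI , b' , w'' , eq , redex)
      | w''' ∷ʳ′ c =
    irr (w' , a , wI , b' , w''' ,
         proj₁ (∷ʳ-injective v _ (trans eq (factor-snoc w' a wI b' w''' c))) , redex)

module Expansion (G : Graph) (B : VS G) where
  open Congruence G
  open VS B using (Trans)

  -- Saturation only adds ε-transitions.
  sat-visible : ∀ {p a p'} → SatTrans G B p (just a) p' → Trans p (just a) p'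
  sat-visible (base t) = t

  Reaches : State G B → Word G → State G B → Word G → Set
  Reaches p u p' w = ∃ λ u' → u' ≈ w × Run G B (p , u) (p' , u')

  mutual
    expand-ε : ∀ {p p'} → SatTrans G B p nothing p' → ∀ u → RI u → Reaches p u p' u
    expand-ε (base t) u ri =
      u ++ [] , ≈-unitʳ u , step nothing t (RI-resp (≅-sym (≈-unitʳ u)) ri) ◅ ε
    expand-ε (rule1 o s₁ ep s₂) u ri = expand-cancelling (≅-cancel o) s₁ ep s₂ u ri
    expand-ε (rule2 o s₁ ep s₂ Ioo) u ri = expand-cancelling (minus-plus o Ioo) s₁ ep s₂ u ri

    expand-cancelling : ∀ {p₁ p p' p₂ x y} → x ∷ y ∷ [] ≈ [] →
      SatTrans G B p₁ (just x) p → EpsPath G B p p' → SatTrans G B p' (just y) p₂ →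
      ∀ u → RI u → Reaches p₁ u p₂ u
    expand-cancelling {x = x} {y} c s₁ ep s₂ u ri =
      let ri₁ = RI-extend u x y c ri
          (u₁ , u₁≈ux , run₁) = expand-path ep (u ++ [ x ]) ri₁
          u₁y≈u : u₁ ++ [ y ] ≈ u
          u₁y≈u = ≅-trans (≈-appendʳ [ y ] u₁≈ux) (cancel-pair u x y c)
      in u₁ ++ [ y ] , u₁y≈u ,
         step (just x) (sat-visible s₁) ri₁
           ◅ run₁ ◅◅ step (just y) (sat-visible s₂) (RI-resp (≅-sym u₁y≈u) ri) ◅ ε

    expand-path : ∀ {p p'} → EpsPath G B p p' → ∀ u → RI u → Reaches p u p' u
    expand-path ε-refl u ri = u , ≅-refl , ε
    expand-path (ε-step s ep) u ri =
      let (u₁ , u₁≈u , run₁) = expand-ε s u ri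
          (u₂ , u₂≈u₁ , run₂) = expand-path ep u₁ (RI-resp (≅-sym u₁≈u) ri)
      in u₂ , ≅-trans u₂≈u₁ u₁≈u , run₁ ◅◅ run₂

  simulate-sat-step : ∀ {q w q' w'} → Step G (sat G B) (q , w) (q' , w') →
                      ∀ u → u ≈ w → Reaches q u q' w'
  simulate-sat-step (step (just x) s ri) u u≈w =
    u ++ [ x ] , ≈-appendʳ [ x ] u≈w ,
    step (just x) (sat-visible s) (RI-resp (≅-sym (≈-appendʳ [ x ] u≈w)) ri) ◅ ε
  simulate-sat-step {w = w} (step nothing s ri) u u≈w =
    let u≈w[] = ≅-trans u≈w (≅-sym (≈-unitʳ w))
        (u₁ , u₁≈u , run) = expand-ε s u (RI-resp (≅-sym u≈w[]) ri)
    in u₁ , ≅-trans u₁≈u u≈w[] , run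

  simulate-sat-run : ∀ {q w q' w'} → Run G (sat G B) (q , w) (q' , w') →
                     ∀ u → u ≈ w → Reaches q u q' w'
  simulate-sat-run ε u u≈w = u , u≈w , ε
  simulate-sat-run (s ◅ r) u u≈w =
    let (u₁ , u₁≈w₁ , run₁) = simulate-sat-step s u u≈w
        (u₂ , u₂≈w' , run₂) = simulate-sat-run r u₁ u₁≈w₁
    in u₂ , u₂≈w' , run₁ ◅◅ run₂

module Normalisation (G : Graph) (B : VS G) (dep : Dependent G B) (q₁ : State G B) where
  open Congruence G
  open Irreducibility G
  open VS B using (Trans)

  Visible : Op G → Set
  Visible x = ∃₂ λ p p' → Trans p (just x) p'

  visible-dependent : DependentAlphabet Visible
  visible-dependent (_ , _ , t) (_ , _ , t') = dep t t'

  -- The trailing ε-path is kept explicit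
  -- so that a later cancelling letter can be absorbed by rule (1).
  data PushRun : State G B → Word G → Set where
    start : ∀ {q} → EpsPath G B q₁ q → PushRun q []
    push  : ∀ {q₀ p q v a} → PushRun q₀ v → SatTrans G B q₀ (just a) p → EpsPath G B p q →
            RI (v ++ [ a ]) → PushRun q (v ++ [ a ])

  eps-snoc : ∀ {p q r} → EpsPath G B p q → SatTrans G B q nothing r → EpsPath G B p r
  eps-snoc ε-refl s = ε-step s ε-refl
  eps-snoc (ε-step s' ep) s = ε-step s' (eps-snoc ep s)

  extend : ∀ {q q' v} → PushRun q v → SatTrans G B q nothing q' → PushRun q' v
  extend (start ep) s = start (eps-snoc ep s)
  extend (push r t ep ri) s = push r t (eps-snoc ep s) ri

  eps-run : ∀ {q q' v} → EpsPath G B q q' → RI v → Run G (sat G B) (q , v) (q' , v)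
  eps-run ε-refl ri = ε
  eps-run {q} {v = v} (ε-step {p' = p'} s ep) ri =
    subst (λ z → Step G (sat G B) (q , v) (p' , z)) (++-identityʳ v)
          (step nothing s (RI-resp (≅-sym (≈-unitʳ v)) ri))
    ◅ eps-run ep ri

  to-run : ∀ {q v} → PushRun q v → Run G (sat G B) (q₁ , []) (q , v)
  to-run (start ep) = eps-run ep RI-[]
  to-run (push r t ep ri) = to-run r ◅◅ step (just _) t ri ◅ eps-run ep ri

  record Tracked (q : State G B) (w : Word G) : Set where
    constructor tracked
    field
      normal      : Word G
      run         : PushRun q normal
      visible     : All Visible normal
      irreducible : Irreducible G normal
      congruent   : w ≈ normal

  initial : Tracked q₁ []
  initial = tracked [] (start ε-refl) [] irreducible-[] ≅-refl

  track-push : ∀ {q q' w b} (T : Tracked q w) → Trans q (just b) q' → RI (w ++ [ b ]) →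
               ¬ CancelsLast (Tracked.normal T) b → Tracked q' (w ++ [ b ])
  track-push {w = w} {b = b} (tracked v r vis irr w≈v) t ri ¬c =
    tracked (v ++ [ b ]) (push r (base t) ε-refl (RI-resp wb≈vb ri)) (++⁺ vis (Vb ∷ []))
            (irreducible-snoc visible-dependent v b irr vis Vb ¬c) wb≈vb
    where
    wb≈vb : w ++ [ b ] ≈ v ++ [ b ]
    wb≈vb = ≈-appendʳ [ b ] w≈v
    Vb : Visible b
    Vb = _ , _ , t

  -- o⁻ cancels the last pushed o⁺: rule (1) turns push, ε-path, o⁻ into one ε-step.
  track-cancel : ∀ {q₀ p q q' v w o} → PushRun q₀ v → SatTrans G B q₀ (just (o , plus)) p →
    EpsPath G B p q → All Visible (v ++ [ (o , plus) ]) → Irreducible G (v ++ [ (o , plus) ]) →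
    w ≈ v ++ [ (o , plus) ] → Trans q (just (o , minus)) q' → Tracked q' (w ++ [ (o , minus) ])
  track-cancel {v = v} {o = o} r s ep vis irr w≈v t =
    tracked v (extend r (rule1 o s ep (base t))) (++⁻ˡ v vis) (irreducible-prefix v _ irr)
            (≅-trans (≈-appendʳ [ (o , minus) ] w≈v) (cancel-pair v _ _ (≅-cancel o)))

  track-read : ∀ {q q' w b} → Tracked q w → Trans q (just b) q' → RI (w ++ [ b ]) →
               Tracked q' (w ++ [ b ])
  track-read T@(tracked _ (start _) _ _ _) t ri = track-push T t ri ¬CancelsLast-[]
  track-read {b = b} T@(tracked _ (push {v = v} {a = a} r s ep _) vis irr w≈v) t ri
    with cancelling? a b
  ... | yes (o , refl , refl) = track-cancel r s ep vis irr w≈v t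
  ... | no ¬ab = track-push T t ri (λ c → ¬ab (CancelsLast-snoc v a b c))

  track-step : ∀ {q w q' w'} → Tracked q w → Step G B (q , w) (q' , w') → Tracked q' w'
  track-step (tracked v r vis irr w≈v) (step nothing t _) =
    tracked v (extend r (base t)) vis irr (≅-trans (≈-unitʳ _) w≈v)
  track-step T (step (just b) t ri) = track-read T t ri

  track-run : ∀ {q w q' w'} → Tracked q w → Run G B (q , w) (q' , w') → Tracked q' w'
  track-run T ε = T
  track-run T (s ◅ r) = track-run (track-step T s) r

lemma20 : (G : Graph) (B : VS G) → Dependent G B → (q₁ q₂ : State G B) →
    ((u : Word G) → Run G B (q₁ , []) (q₂ , u) →
       ∃ λ v → Irreducible G v × _≅_ G u v × Run G (sat G B) (q₁ , []) (q₂ , v))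
    × ((v : Word G) → Irreducible G v → Run G (sat G B) (q₁ , []) (q₂ , v) →
       ∃ λ u → _≅_ G u v × Run G B (q₁ , []) (q₂ , u))
lemma20 G B dep q₁ q₂ = normalise , expand
  where
  open Normalisation G B dep q₁ using (tracked; initial; track-run; to-run)
  open Expansion G B using (simulate-sat-run)

  normalise : (u : Word G) → Run G B (q₁ , []) (q₂ , u) →
    ∃ λ v → Irreducible G v × _≅_ G u v × Run G (sat G B) (q₁ , []) (q₂ , v)
  normalise u r with track-run initial r
  ... | tracked v pushes _ irr u≈v = v , irr , u≈v , to-run pushes

  expand : (v : Word G) → Irreducible G v → Run G (sat G B) (q₁ , []) (q₂ , v) →
    ∃ λ u → _≅_ G u v × Run G B (q₁ , []) (q₂ , u)
  expand v _ r = simulate-sat-run r [] ≅-refl
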